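{- Let $D$ be a digraph of order $n$ and let $D'$ be the spanning subdigraph of $D$ whose arcs are exactly the forcing arcs of $D$. Then $D$ is locatable with $\gamma_{OL}(D)=n$ if and only if $D'$ is a disjoint union of directed cycles covering all vertices of $D$ (i.e. every vertex has exactly one incoming and exactly one outgoing forcing arc).
   Context: Digraphs are finite and may contain loops; for each ordered pair $(x,y)$ there is at most one arc $xy$. Directed cycles may have length $1$ (a loop) or $2$ (arcs $xy$ and $yx$). $N^-(v)$ is the set of vertices $u$ such that $uv$ is an arc (including $v$ if $v$ has a loop). An OLD set of $D$ is a set $S\subseteq V(D)$ such that every vertex has an in-neighbour in $S$ and for every two distinct vertices $u,v$, some vertex of $S$ lies in $N^-(u)\ominus N^-(v)$ (symmetric difference). $D$ is locatable if it admits an OLD set; $\gamma_{OL}(D)$ is the minimum size of an OLD set. An arc $xy$ of $D$ is a forcing arc if either $N^-(y)=\{x\}$, or there is a vertex $z$ with $N^-(y)\ominus N^-(z)=\{x\}$. -}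

module Defs where

open import Data.Nat using (ℕ; _≤_)
open import Data.Bool using (Bool; true; false; _xor_; T)
open import Data.Fin using (Fin)
open import Data.Fin.Subset using (Subset; _∈_; ∣_∣)
open import Data.Product using (Σ; ∃; _×_; _,_)
open import Data.Sum using (_⊎_)
open import Relation.Nullary using (¬_)
open import Relation.Binary.PropositionalEquality using (_≡_)

-- A digraph of order n: vertex set Fin n, arc relation given by a Boolean
-- adjacency function (arc x → y iff Arc x y ≡ true). Loops allowed
-- (Arc v v ≡ true), at most one arc per ordered pair automatically.
record Digraph (n : ℕ) : Set where
  field
    Arc : Fin n → Fin n → Bool
open Digraph public

InSymDiff : ∀ {n} (D : Digraph n) → Fin n → Fin n → Fin n → Set
InSymDiff D u v w = T (Arc D u v xor Arc D u w)

IsOLD : ∀ {n} (D : Digraph n) → Subset n → Set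
IsOLD {n} D S =
  ((v : Fin n) → ∃ λ u → u ∈ S × T (Arc D u v)) ×
  ((u v : Fin n) → ¬ u ≡ v → ∃ λ w → w ∈ S × InSymDiff D w u v)

Locatable : ∀ {n} → Digraph n → Set
Locatable {n} D = ∃ λ (S : Subset n) → IsOLD D S

γOL≡ : ∀ {n} → Digraph n → ℕ → Set
γOL≡ {n} D k =
  (∃ λ (S : Subset n) → IsOLD D S × ∣ S ∣ ≡ k) ×
  ((S : Subset n) → IsOLD D S → k ≤ ∣ S ∣)

InNbhdSingleton : ∀ {n} (D : Digraph n) → Fin n → Fin n → Set
InNbhdSingleton {n} D y x = (u : Fin n) → (T (Arc D u y) → u ≡ x) × (u ≡ x → T (Arc D u y))

SymDiffSingleton : ∀ {n} (D : Digraph n) → Fin n → Fin n → Fin n → Set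
SymDiffSingleton {n} D y z x = (u : Fin n) → (InSymDiff D u y z → u ≡ x) × (u ≡ x → InSymDiff D u y z)

ForcingArc : ∀ {n} (D : Digraph n) → Fin n → Fin n → Set
ForcingArc {n} D x y =
  T (Arc D x y) × (InNbhdSingleton D y x ⊎ (∃ λ (z : Fin n) → SymDiffSingleton D y z x))

ExactlyOne : ∀ {n} → (Fin n → Set) → Set
ExactlyOne {n} P = ∃ λ a → P a × ((b : Fin n) → P b → b ≡ a)

ForcingArcsCycleCover : ∀ {n} → Digraph n → Set
ForcingArcsCycleCover {n} D =
  (v : Fin n) → ExactlyOne (λ u → ForcingArc D u v) × ExactlyOne (λ w → ForcingArc D v w)

-- A forcing arc xy has a tail x that is the only possible witness for the
-- domination of y or for the separation of y from some z, so the tail of every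
-- forcing arc lies in every OLD set. Hence a cycle cover by forcing arcs forces
-- γ_OL(D) = n; V itself is OLD, since two vertices with equal in-neighbourhoods
-- would share the forcing arc entering them, giving its tail two out-arcs.
-- Conversely, if γ_OL(D) = n then no V ∖ {x} is OLD, which yields a forcing arc
-- out of every x. Regard the empty set and the n in-neighbourhoods as n + 1
-- rows of a 0/1 matrix with n columns: a forcing arc out of x gives two rows
-- differing exactly in column x. Contracting such a pair removes one row and one
-- column and never merges rows differing elsewhere; contracting every column
-- except two columns p, q leaves 3 rows, so at most three of the four patterns
-- occur on (p, q). Two forcing arcs with a common tail, or with a common head,
-- would exhibit all four, so the forcing arcs form an injective, hence
-- bijective, map V → V.
module Submission where

open import Data.Bool using (Bool; true; false; T; _xor_)
open import Data.Bool.Properties using (xor-comm; ¬-not) renaming (_≟_ to _≟ᵇ_)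
open import Data.Empty using (⊥-elim)
open import Data.Fin using (Fin; zero; suc; punchIn; punchOut)
open import Data.Fin.Patterns using (0F; 1F; 2F; 3F)
open import Data.Fin.Properties
  using (_≟_; ¬Fin0; suc-injective; any?; all?; injective⇒≤;
         punchIn-injective; punchInᵢ≢i; punchIn-punchOut; punchOut-injective)
open import Data.Fin.Subset using (⊤; ⁅_⁆; ∁; ∣_∣; _⊆_; _⊂_) renaming (_∈_ to _∈ₛ_)
open import Data.Fin.Subset.Properties
  using (∈⊤; ⊆⊤; ∣⊤∣≡n; x∈⁅x⁆; x∈⁅y⁆⇒x≡y; x∈p⇒x∉∁p; x∉∁p⇒x∈p; p⊂q⇒∣p∣<∣q∣; p⊆q⇒∣p∣≤∣q∣; _∈?_)
open import Data.Nat using (ℕ; zero; suc; _+_; _≤_; _<_; s≤s)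
open import Data.Nat.Properties using (+-comm; 1+n≰n; ≤⇒≯)
open import Data.Product using (∃; ∃₂; _×_; _,_; proj₁; proj₂; map₁; map₂)
open import Data.Sum using (_⊎_; inj₁; inj₂; [_,_])
open import Function using (_∘_)
open import Function.Bundles using (_⇔_; mk⇔)
open import Function.Definitions using (Injective)
open import Relation.Nullary using (¬_; Dec; yes; no; contradiction)
open import Relation.Nullary.Decidable using (T?; decidable-stable; _×-dec_; _⊎-dec_; _→-dec_)
open import Relation.Unary using (Decidable)
open import Relation.Binary.PropositionalEquality hiding ([_])

open import Defs

≢⇒either : ∀ {a b : Bool} → a ≢ b → ∀ c → c ≡ a ⊎ c ≡ b
≢⇒either {a} {b} a≢b c with c ≟ᵇ a
... | yes c≡a = inj₁ c≡a
... | no c≢a  = inj₂ (trans (¬-not c≢a) (sym (¬-not (a≢b ∘ sym))))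

xor⇒≢ : ∀ {a b} → T (a xor b) → a ≢ b
xor⇒≢ {true}  () refl
xor⇒≢ {false} () refl

¬xor⇒≡ : ∀ {a b} → ¬ T (a xor b) → a ≡ b
¬xor⇒≡ {true}  {true}  _  = refl
¬xor⇒≡ {false} {false} _  = refl
¬xor⇒≡ {true}  {false} ¬t = contradiction _ ¬t
¬xor⇒≡ {false} {true}  ¬t = contradiction _ ¬t

T-xorʳ : ∀ {a b} → T (a xor b) → ¬ T a → T b
T-xorʳ {true}  _ ¬a = contradiction _ ¬a
T-xorʳ {false} t _  = t

T⇒≡true : ∀ {a} → T a → a ≡ true
T⇒≡true {true} _ = refl

¬T⇒≡false : ∀ {a} → ¬ T a → a ≡ false
¬T⇒≡false {true}  ¬t = contradiction _ ¬t
¬T⇒≡false {false} _  = refl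

IsSingleton : ∀ {n} → (Fin n → Set) → Fin n → Set
IsSingleton P x = ∀ u → (P u → u ≡ x) × (u ≡ x → P u)

isSingleton? : ∀ {n} {P : Fin n → Set} → Decidable P → ∀ x → Dec (IsSingleton P x)
isSingleton? P? x = all? λ u → (P? u →-dec u ≟ x) ×-dec (u ≟ x →-dec P? u)

isSingleton-cong : ∀ {n} {P Q : Fin n → Set} {x} → (∀ u → P u → Q u) → (∀ u → Q u → P u) →
                   IsSingleton P x → IsSingleton Q x
isSingleton-cong P⇒Q Q⇒P sing u = proj₁ (sing u) ∘ Q⇒P u , P⇒Q u ∘ proj₂ (sing u)

witnessOutside⊎isSingleton : ∀ {n} {P : Fin n → Set} → Decidable P → ∀ x → ∃ P →
                              (∃ λ u → u ∈ₛ ∁ ⁅ x ⁆ × P u) ⊎ IsSingleton P x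
witnessOutside⊎isSingleton {P = P} P? x (u₀ , Pu₀) with any? (λ u → u ∈? ∁ ⁅ x ⁆ ×-dec P? u)
... | yes found = inj₁ found
... | no none   = inj₂ λ u → only-x u , λ { refl → subst P (only-x u₀ Pu₀) Pu₀ }
  where
  only-x : ∀ u → P u → u ≡ x
  only-x u Pu = x∈⁅y⁆⇒x≡y x (x∉∁p⇒x∈p λ u∈ → none (u , u∈ , Pu))

injective⇒surjective : ∀ {n} {f : Fin n → Fin n} → Injective _≡_ _≡_ f → ∀ y → ∃ λ x → f x ≡ y
injective⇒surjective {suc n} {f} inj y with any? (λ x → f x ≟ y)
... | yes found = found
... | no  ∄x    = contradiction (injective⇒≤ (inj ∘ punchOut-injective (y≢f _) (y≢f _))) 1+n≰n
  where
  y≢f : ∀ x → y ≢ f x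
  y≢f x y≡fx = ∄x (x , sym y≡fx)

punchIn₂ : ∀ {m} {p q : Fin (suc (suc m))} → p ≢ q → Fin m → Fin (suc (suc m))
punchIn₂ {p = p} p≢q c = punchIn p (punchIn (punchOut p≢q) c)

punchIn₂-injective : ∀ {m} {p q : Fin (suc (suc m))} (p≢q : p ≢ q) → Injective _≡_ _≡_ (punchIn₂ p≢q)
punchIn₂-injective {p = p} p≢q {c} {c′} =
  punchIn-injective (punchOut p≢q) c c′ ∘ punchIn-injective p _ _

punchIn₂≢ˡ : ∀ {m} {p q : Fin (suc (suc m))} (p≢q : p ≢ q) c → p ≢ punchIn₂ p≢q c
punchIn₂≢ˡ {p = p} p≢q c = punchInᵢ≢i p _ ∘ sym

punchIn₂≢ʳ : ∀ {m} {p q : Fin (suc (suc m))} (p≢q : p ≢ q) c → q ≢ punchIn₂ p≢q c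
punchIn₂≢ʳ {p = p} p≢q c q≡ =
  punchInᵢ≢i (punchOut p≢q) c (punchIn-injective p _ _ (trans (sym q≡) (sym (punchIn-punchOut p≢q))))

bits : Fin 4 → Bool × Bool
bits 0F = false , false
bits 1F = false , true
bits 2F = true  , false
bits 3F = true  , true

bits⁻¹ : Bool × Bool → Fin 4
bits⁻¹ (false , false) = 0F
bits⁻¹ (false , true)  = 1F
bits⁻¹ (true  , false) = 2F
bits⁻¹ (true  , true)  = 3F

bits-injective : Injective _≡_ _≡_ bits
bits-injective {x} {y} eq = trans (sym (inverse x)) (trans (cong bits⁻¹ eq) (inverse y))
  where
  inverse : ∀ x → bits⁻¹ (bits x) ≡ x
  inverse 0F = refl
  inverse 1F = refl
  inverse 2F = refl
  inverse 3F = refl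

record DifferOnlyAt {k m} {B : Set} (Q : Fin k → Fin m → B) (d : Fin m) (i j : Fin k) : Set where
  constructor differOnlyAt
  field
    differs : Q i d ≢ Q j d
    agrees  : ∀ c → c ≢ d → Q i c ≡ Q j c
open DifferOnlyAt public

-- Merge row j into row i, then delete row j and column zero.
module Contraction {A B : Set} {k m : ℕ} (key : Fin (suc k) → A) (Q : Fin (suc k) → Fin (suc m) → B)
                   {i j : Fin (suc k)} (keyᵢ≡keyⱼ : key i ≡ key j) (ij-split : DifferOnlyAt Q zero i j) where

  merge : Fin (suc k) → Fin (suc k)
  merge t with t ≟ j
  ... | yes _ = i
  ... | no _  = t

  merge-key : ∀ t → key (merge t) ≡ key t
  merge-key t with t ≟ j
  ... | yes refl = keyᵢ≡keyⱼ
  ... | no _     = refl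

  merge-col : ∀ t c → Q (merge t) (suc c) ≡ Q t (suc c)
  merge-col t c with t ≟ j
  ... | yes refl = agrees ij-split (suc c) λ ()
  ... | no _     = refl

  j≢merge : ∀ t → j ≢ merge t
  j≢merge t with t ≟ j
  ... | yes _   = λ { refl → differs ij-split refl }
  ... | no t≢j  = t≢j ∘ sym

  shrink : Fin (suc k) → Fin k
  shrink t = punchOut (j≢merge t)

  key′ : Fin k → A
  key′ t = key (punchIn j t)

  Q′ : Fin k → Fin m → B
  Q′ t c = Q (punchIn j t) (suc c)

  key′-shrink : ∀ t → key′ (shrink t) ≡ key t
  key′-shrink t = trans (cong key (punchIn-punchOut (j≢merge t))) (merge-key t)

  Q′-shrink : ∀ t c → Q′ (shrink t) c ≡ Q t (suc c)
  Q′-shrink t c = trans (cong (λ s → Q s (suc c)) (punchIn-punchOut (j≢merge t))) (merge-col t c)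

  shrink-split : ∀ {d i₁ j₁} → key i₁ ≡ key j₁ → DifferOnlyAt Q (suc d) i₁ j₁ →
                 key′ (shrink i₁) ≡ key′ (shrink j₁) × DifferOnlyAt Q′ d (shrink i₁) (shrink j₁)
  shrink-split {d} {i₁} {j₁} key≡ (differOnlyAt differ agree) =
      trans (key′-shrink i₁) (trans key≡ (sym (key′-shrink j₁)))
    , differOnlyAt (λ eq → differ (trans (sym (Q′-shrink i₁ d)) (trans eq (Q′-shrink j₁ d))))
                   (λ c c≢d → trans (Q′-shrink i₁ c)
                                (trans (agree (suc c) (c≢d ∘ suc-injective)) (sym (Q′-shrink j₁ c))))

cols+distinctKeys≤rows :
  ∀ {A B : Set} {k m b} (key : Fin k → A) (Q : Fin k → Fin m → B) →
  (∀ d → ∃₂ λ i j → key i ≡ key j × DifferOnlyAt Q d i j) →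
  (h : Fin b → Fin k) → Injective _≡_ _≡_ (key ∘ h) →
  m + b ≤ k
cols+distinctKeys≤rows {m = zero} key Q split h inj = injective⇒≤ (inj ∘ cong key)
cols+distinctKeys≤rows {k = zero} {m = suc m} key Q split h inj = ⊥-elim (¬Fin0 (proj₁ (split zero)))
cols+distinctKeys≤rows {k = suc k} {m = suc m} key Q split h inj with split zero
... | i , j , keyᵢ≡keyⱼ , ij-split =
  s≤s (cols+distinctKeys≤rows key′ Q′ split′ (shrink ∘ h) inj′)
  where
  open Contraction key Q keyᵢ≡keyⱼ ij-split
  split′ : ∀ d → ∃₂ λ i′ j′ → key′ i′ ≡ key′ j′ × DifferOnlyAt Q′ d i′ j′
  split′ d with split (suc d)
  ... | i₁ , j₁ , key≡ , split₁ = shrink i₁ , shrink j₁ , shrink-split key≡ split₁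
  inj′ : Injective _≡_ _≡_ (key′ ∘ shrink ∘ h)
  inj′ {x} {y} eq = inj (trans (sym (key′-shrink (h x))) (trans eq (key′-shrink (h y))))

AllPatterns : ∀ {k m} → (Fin k → Fin m → Bool) → Fin m → Fin m → Set
AllPatterns P p q = ∀ a b → ∃ λ t → P t p ≡ a × P t q ≡ b

¬AllPatterns : ∀ {n} (P : Fin (suc n) → Fin n → Bool) → (∀ d → ∃₂ λ i j → DifferOnlyAt P d i j) →
               ∀ {p q} → p ≢ q → ¬ AllPatterns P p q
¬AllPatterns {zero} P split {()}
¬AllPatterns {suc zero} P split {0F} {0F} p≢q = contradiction refl p≢q
¬AllPatterns {suc (suc m)} P split {p} {q} p≢q all =
  1+n≰n (subst (_≤ 3 + m) (+-comm m 4) (cols+distinctKeys≤rows key Q split′ h inj))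
  where
  ι : Fin m → Fin (2 + m)
  ι = punchIn₂ p≢q
  key : Fin (3 + m) → Bool × Bool
  key t = P t p , P t q
  Q : Fin (3 + m) → Fin m → Bool
  Q t c = P t (ι c)
  split′ : ∀ c → ∃₂ λ i j → key i ≡ key j × DifferOnlyAt Q c i j
  split′ c with split (ι c)
  ... | i , j , differOnlyAt differ agree =
    i , j , cong₂ _,_ (agree p (punchIn₂≢ˡ p≢q c)) (agree q (punchIn₂≢ʳ p≢q c)) ,
    differOnlyAt differ λ c′ c′≢c → agree (ι c′) (c′≢c ∘ punchIn₂-injective p≢q)
  h : Fin 4 → Fin (3 + m)
  h x = proj₁ (all (proj₁ (bits x)) (proj₂ (bits x)))
  key∘h≡bits : ∀ x → key (h x) ≡ bits x
  key∘h≡bits x = let _ , Pp≡ , Pq≡ = all (proj₁ (bits x)) (proj₂ (bits x)) in cong₂ _,_ Pp≡ Pq≡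
  inj : Injective _≡_ _≡_ (key ∘ h)
  inj {x} {y} eq = bits-injective (trans (sym (key∘h≡bits x)) (trans eq (key∘h≡bits y)))

differOnlyAt⇒bothValues : ∀ {k m} {P : Fin k → Fin m → Bool} {p q i j u} →
  DifferOnlyAt P p i j → q ≢ p → P i q ≡ u → ∀ a → ∃ λ t → P t p ≡ a × P t q ≡ u
differOnlyAt⇒bothValues {i = i} {j} (differOnlyAt differ agree) q≢p Piq≡u a with ≢⇒either differ a
... | inj₁ refl = i , refl , Piq≡u
... | inj₂ refl = j , refl , trans (sym (agree _ q≢p)) Piq≡u

allPatterns : ∀ {k m} {P : Fin k → Fin m → Bool} {p q u v} → u ≢ v →
  (∀ a → ∃ λ t → P t p ≡ a × P t q ≡ u) → (∀ a → ∃ λ t → P t p ≡ a × P t q ≡ v) →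
  AllPatterns P p q
allPatterns u≢v rowsᵤ rowsᵥ a b with ≢⇒either u≢v b
... | inj₁ refl = rowsᵤ a
... | inj₂ refl = rowsᵥ a

module _ {n : ℕ} (D : Digraph n) where

  inNbhds : Fin (suc n) → Fin n → Bool
  inNbhds zero    _ = false
  inNbhds (suc v) u = Arc D u v

  forcingArc? : ∀ x y → Dec (ForcingArc D x y)
  forcingArc? x y =
    T? (Arc D x y) ×-dec
      (isSingleton? (λ u → T? (Arc D u y)) x ⊎-dec
       any? λ z → isSingleton? (λ u → T? (Arc D u y xor Arc D u z)) x)

  forcingArc⇒split : ∀ {x y} → ForcingArc D x y → ∃ λ j → DifferOnlyAt inNbhds x (suc y) j
  forcingArc⇒split (xy , inj₁ sing) =
    zero , differOnlyAt (λ eq → subst T eq xy) (λ c c≢x → ¬T⇒≡false (c≢x ∘ proj₁ (sing c)))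
  forcingArc⇒split {x} (_ , inj₂ (z , sd)) =
    suc z , differOnlyAt (xor⇒≢ (proj₂ (sd x) refl)) (λ c c≢x → ¬xor⇒≡ (c≢x ∘ proj₁ (sd c)))

  forcingArc-cong : ∀ {x y y′} → (∀ w → Arc D w y ≡ Arc D w y′) → ForcingArc D x y → ForcingArc D x y′
  forcingArc-cong {x} same (xy , inj₁ sing) =
    subst T (same x) xy , inj₁ (isSingleton-cong (λ w → subst T (same w)) (λ w → subst T (sym (same w))) sing)
  forcingArc-cong {x} same (xy , inj₂ (z , sd)) =
    subst T (same x) xy , inj₂ (z , isSingleton-cong (λ w → subst (T ∘ (_xor Arc D w z)) (same w))
                                                     (λ w → subst (T ∘ (_xor Arc D w z)) (sym (same w))) sd)

  symDiffSingleton-sym : ∀ {y z x} → SymDiffSingleton D y z x → SymDiffSingleton D z y x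
  symDiffSingleton-sym {y} {z} =
    isSingleton-cong (λ u → subst T (xor-comm (Arc D u y) (Arc D u z)))
                     (λ u → subst T (xor-comm (Arc D u z) (Arc D u y)))

  symDiffSingleton⇒forcingArc : ∀ {y z x} → SymDiffSingleton D y z x → ForcingArc D x y ⊎ ForcingArc D x z
  symDiffSingleton⇒forcingArc {y} {z} {x} sd with T? (Arc D x y)
  ... | yes xy = inj₁ (xy , inj₂ (z , sd))
  ... | no ¬xy = inj₂ (T-xorʳ (proj₂ (sd x) refl) ¬xy , inj₂ (y , symDiffSingleton-sym sd))

  IsOLD-mono : ∀ {S S′} → S ⊆ S′ → IsOLD D S → IsOLD D S′
  IsOLD-mono S⊆S′ (dom , sep) = (λ v → map₂ (map₁ S⊆S′) (dom v)) , λ u v u≢v → map₂ (map₁ S⊆S′) (sep u v u≢v)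

  forcingArc⇒tail∈OLD : ∀ {x y S} → ForcingArc D x y → IsOLD D S → x ∈ₛ S
  forcingArc⇒tail∈OLD {S = S} (_ , inj₁ sing) (dom , _) =
    let u , u∈S , uy = dom _ in subst (_∈ₛ S) (proj₁ (sing u) uy) u∈S
  forcingArc⇒tail∈OLD {x} {y} {S} (_ , inj₂ (z , sd)) (_ , sep) =
    let w , w∈S , w-sep = sep y z y≢z in subst (_∈ₛ S) (proj₁ (sd w) w-sep) w∈S
    where
    y≢z : y ≢ z
    y≢z refl = xor⇒≢ {Arc D x y} (proj₂ (sd x) refl) refl

  noForcingArcFrom⇒IsOLD-∁⁅x⁆ : ∀ {x} → IsOLD D ⊤ → (∀ y → ¬ ForcingArc D x y) → IsOLD D (∁ ⁅ x ⁆)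
  noForcingArcFrom⇒IsOLD-∁⁅x⁆ {x} (dom , sep) ∄y = dom′ , sep′
    where
    dom′ : ∀ v → ∃ λ u → u ∈ₛ ∁ ⁅ x ⁆ × T (Arc D u v)
    dom′ v with witnessOutside⊎isSingleton (λ u → T? (Arc D u v)) x (map₂ proj₂ (dom v))
    ... | inj₁ found = found
    ... | inj₂ sing  = contradiction (proj₂ (sing x) refl , inj₁ sing) (∄y v)
    sep′ : ∀ u v → u ≢ v → ∃ λ w → w ∈ₛ ∁ ⁅ x ⁆ × InSymDiff D w u v
    sep′ u v u≢v with witnessOutside⊎isSingleton (λ w → T? (Arc D w u xor Arc D w v)) x
                                                 (map₂ proj₂ (sep u v u≢v))
    ... | inj₁ found = found
    ... | inj₂ sing  = ⊥-elim ([ ∄y u , ∄y v ] (symDiffSingleton⇒forcingArc sing))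

  ∣∁⁅x⁆∣<n : ∀ (x : Fin n) → ∣ ∁ ⁅ x ⁆ ∣ < n
  ∣∁⁅x⁆∣<n x = subst (∣ ∁ ⁅ x ⁆ ∣ <_) (∣⊤∣≡n n) (p⊂q⇒∣p∣<∣q∣ ∁⁅x⁆⊂⊤)
    where
    ∁⁅x⁆⊂⊤ : ∁ ⁅ x ⁆ ⊂ ⊤
    ∁⁅x⁆⊂⊤ = ⊆⊤ , x , ∈⊤ , x∈p⇒x∉∁p (x∈⁅x⁆ x)

  forcingArcFrom : IsOLD D ⊤ → (∀ S → IsOLD D S → n ≤ ∣ S ∣) → ∀ x → ∃ (ForcingArc D x)
  forcingArcFrom old minimum x = decidable-stable (any? (forcingArc? x)) λ ∄y →
    ≤⇒≯ (minimum _ (noForcingArcFrom⇒IsOLD-∁⁅x⁆ old (λ y xy → ∄y (y , xy)))) (∣∁⁅x⁆∣<n x)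

  sameTail⇒allPatterns : ∀ {x y y′ w} → ForcingArc D x y → ForcingArc D x y′ → InSymDiff D w y y′ →
                         x ≢ w × AllPatterns inNbhds x w
  sameTail⇒allPatterns {x} {w = w} xy xy′ w-sep =
    w≢x ∘ sym , allPatterns {P = inNbhds} (xor⇒≢ w-sep) (bothValues xy) (bothValues xy′)
    where
    w≢x : w ≢ x
    w≢x refl = xor⇒≢ w-sep (trans (T⇒≡true (proj₁ xy)) (sym (T⇒≡true (proj₁ xy′))))
    bothValues : ∀ {y} → ForcingArc D x y → ∀ a → ∃ λ t → inNbhds t x ≡ a × inNbhds t w ≡ Arc D w y
    bothValues xy = differOnlyAt⇒bothValues (proj₂ (forcingArc⇒split xy)) w≢x refl

  sameHead⇒allPatterns : ∀ {x x′ y} → ForcingArc D x y → ForcingArc D x′ y → x ≢ x′ →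
                         AllPatterns inNbhds x x′
  sameHead⇒allPatterns {x} {x′} xy x′y x≢x′ = allPatterns {P = inNbhds} (λ ()) rows₁ rows₀
    where
    rows₁ : ∀ a → ∃ λ t → inNbhds t x ≡ a × inNbhds t x′ ≡ true
    rows₁ = differOnlyAt⇒bothValues (proj₂ (forcingArc⇒split xy)) (x≢x′ ∘ sym) (T⇒≡true (proj₁ x′y))
    rows₀ : ∀ a → ∃ λ t → inNbhds t x ≡ a × inNbhds t x′ ≡ false
    rows₀ false = zero , refl , refl
    rows₀ true with forcingArc⇒split x′y
    ... | j , differOnlyAt differ agree =
      j , trans (sym (agree x x≢x′)) (T⇒≡true (proj₁ xy)) ,
      ¬-not (λ eq → differ (trans (T⇒≡true (proj₁ x′y)) (sym eq)))

  module Forward (old : IsOLD D ⊤) (forcingFrom : ∀ x → ∃ (ForcingArc D x)) where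

    split : ∀ d → ∃₂ λ i j → DifferOnlyAt inNbhds d i j
    split d = let y , dy = forcingFrom d in suc y , forcingArc⇒split dy

    out-unique : ∀ {x y y′} → ForcingArc D x y → ForcingArc D x y′ → y′ ≡ y
    out-unique {y = y} {y′} xy xy′ = decidable-stable (y′ ≟ y) λ y′≢y →
      let w , _ , w-sep = proj₂ old y y′ (y′≢y ∘ sym)
          x≢w , patterns = sameTail⇒allPatterns xy xy′ w-sep
      in  ¬AllPatterns inNbhds split x≢w patterns

    in-unique : ∀ {x x′ y} → ForcingArc D x y → ForcingArc D x′ y → x′ ≡ x
    in-unique {x} {x′} xy x′y = decidable-stable (x′ ≟ x) λ x′≢x →
      ¬AllPatterns inNbhds split (x′≢x ∘ sym) (sameHead⇒allPatterns xy x′y (x′≢x ∘ sym))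

    successor : Fin n → Fin n
    successor = proj₁ ∘ forcingFrom

    successor-injective : Injective _≡_ _≡_ successor
    successor-injective {x} {x′} eq =
      sym (in-unique (proj₂ (forcingFrom x)) (subst (ForcingArc D x′) (sym eq) (proj₂ (forcingFrom x′))))

    cycleCover : ForcingArcsCycleCover D
    cycleCover v = into , successor v , proj₂ (forcingFrom v) , λ _ → out-unique (proj₂ (forcingFrom v))
      where
      into : ExactlyOne λ u → ForcingArc D u v
      into with injective⇒surjective successor-injective v
      ... | x , refl = x , proj₂ (forcingFrom x) , λ _ → in-unique (proj₂ (forcingFrom x))

  module Backward (cover : ForcingArcsCycleCover D) where

    IsOLD-⊤ : IsOLD D ⊤
    IsOLD-⊤ = dom , sep
      where
      dom : ∀ v → ∃ λ u → u ∈ₛ ⊤ × T (Arc D u v)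
      dom v = let (x , (xv , _) , _) , _ = cover v in x , ∈⊤ , xv
      sep : ∀ u v → u ≢ v → ∃ λ w → w ∈ₛ ⊤ × InSymDiff D w u v
      sep u v u≢v with any? (λ w → T? (Arc D w u xor Arc D w v))
      ... | yes (w , w-sep) = w , ∈⊤ , w-sep
      ... | no ∄w =
        let x , xu , _    = proj₁ (cover u)
            _ , _ , only = proj₂ (cover x)
        in  contradiction (trans (only u xu) (sym (only v (forcingArc-cong same xu)))) u≢v
        where
        same : ∀ w → Arc D w u ≡ Arc D w v
        same w = ¬xor⇒≡ (λ w-sep → ∄w (w , w-sep))

    ⊤⊆OLD : ∀ {S} → IsOLD D S → ⊤ ⊆ S
    ⊤⊆OLD old {x} _ = let _ , xy , _ = proj₂ (cover x) in forcingArc⇒tail∈OLD xy old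

    γOL≡n : γOL≡ D n
    γOL≡n = (⊤ , IsOLD-⊤ , ∣⊤∣≡n n) , λ S old → subst (_≤ ∣ S ∣) (∣⊤∣≡n n) (p⊆q⇒∣p∣≤∣q∣ (⊤⊆OLD old))

theorem2p9 : (n : ℕ) (D : Digraph n) → (Locatable D × γOL≡ D n) ⇔ ForcingArcsCycleCover D
theorem2p9 n D = mk⇔ forward backward
  where
  forward : Locatable D × γOL≡ D n → ForcingArcsCycleCover D
  forward ((S , old) , _ , minimum) = Forward.cycleCover D old⊤ (forcingArcFrom D old⊤ minimum)
    where
    old⊤ : IsOLD D ⊤
    old⊤ = IsOLD-mono D ⊆⊤ old
  backward : ForcingArcsCycleCover D → Locatable D × γOL≡ D n
  backward cover = (⊤ , Backward.IsOLD-⊤ D cover) , Backward.γOL≡n D cover
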